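{- Let $n \in \mathbb{N}$ be such that both $n$ and $n-2$ are prime. Let $C_n$ be a cyclic group of order $n$ and $H = \mathcal{B}_{\pm}(C_n)$. Then $\Delta^{\ast}(H) = \{1, n-2\}$.
   Context: For a subset $G_0$ of an abelian group $G$, a sequence over $G_0$ is a finite unordered list $S = g_1\cdots g_\ell$ of elements of $G_0$ (repetitions allowed), forming the free commutative monoid over $G_0$ under concatenation. $S$ is a plus-minus weighted zero-sum sequence if $\sum_i \epsilon_i g_i = 0$ for some $\epsilon_i\in\{+1,-1\}$; $\mathcal{B}_{\pm}(G_0)$ is the monoid of these. For a monoid $H$ with trivial unit group: an atom is a non-identity element not a product of two non-identity elements; $\mathsf{L}_H(a)$ is the set of $k$ such that $a$ is a product of $k$ atoms; for finite $L=\{a_0<\dots<a_k\}$, $\Delta(L)=\{a_i-a_{i-1}\}$; $\Delta(H)=\bigcup_a\Delta(\mathsf{L}_H(a))$; a submonoid $S$ is divisor-closed if every divisor in $H$ of an element of $S$ lies in $S$; $\Delta^{\ast}(H)=\{\min\Delta(S)\colon S \text{ divisor-closed submonoid},\ \Delta(S)\ne\emptyset\}$. -}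

module Defs where

open import Data.Nat using (ℕ; zero; suc; _∸_; _≤_; _<_)
open import Data.Fin using (Fin; toℕ)
import Data.Fin as Fin
open import Data.Vec using (Vec; zipWith; replicate; lookup)
open import Data.List using (List; length; foldr)
open import Data.List.Relation.Unary.All using (All)
open import Data.Integer using (ℤ; +_)
import Data.Integer as ℤ
open import Data.Integer.Divisibility renaming (_∣_ to _∣ℤ_)
open import Data.Product using (Σ; ∃; _×_; _,_)
open import Data.Sum using (_⊎_)
open import Relation.Nullary using (¬_)
open import Relation.Binary.PropositionalEquality using (_≡_; _≢_)

-- The cyclic group C_n is modelled as Fin n with addition mod n,
-- the element i corresponding to the residue toℕ i.
-- A sequence over C_n (element of the free commutative monoid F(C_n))
-- is given by its multiplicity vector: entry i = number of copies of i.
Seq : ℕ → Set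
Seq n = Vec ℕ n

_·_ : ∀ {n} → Seq n → Seq n → Seq n
_·_ = zipWith Data.Nat._+_

𝟙 : ∀ {n} → Seq n
𝟙 = replicate _ 0

ΣFin : ∀ {n} → (Fin n → ℤ) → ℤ
ΣFin {zero} f = + 0
ΣFin {suc n} f = f Fin.zero ℤ.+ ΣFin (λ i → f (Fin.suc i))

-- S is a plus-minus weighted zero-sum sequence over C_n:
-- there is a choice of signs; a i of the copies of i get sign +1 and the
-- remaining (S i - a i) copies get sign -1, such that the signed sum is 0 in Z/n.
IsPMZeroSum : (n : ℕ) → Seq n → Set
IsPMZeroSum n S =
  Σ (Vec ℕ n) λ a →
    (∀ i → lookup a i ≤ lookup S i) ×
    (+ n ∣ℤ ΣFin (λ i → ((+ lookup a i) ℤ.- (+ (lookup S i ∸ lookup a i))) ℤ.* (+ toℕ i)))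

Bpm : (n : ℕ) → Seq n → Set
Bpm n = IsPMZeroSum n

IsAtom : ∀ {n} → (Seq n → Set) → Seq n → Set
IsAtom M a =
  M a × a ≢ 𝟙 ×
  (∀ b c → M b → M c → a ≡ b · c → b ≡ 𝟙 ⊎ c ≡ 𝟙)

HasLength : ∀ {n} → (Seq n → Set) → Seq n → ℕ → Set
HasLength M a k =
  Σ (List _) λ as → length as ≡ k × All (IsAtom M) as × foldr _·_ 𝟙 as ≡ a

InDelta : ∀ {n} → (Seq n → Set) → ℕ → Set
InDelta M d =
  ∃ λ a → M a × ∃ λ k → ∃ λ l →
    HasLength M a k × HasLength M a l × k < l × d ≡ l ∸ k ×
    (∀ m → HasLength M a m → ¬ (k < m × m < l))

IsMinDelta : ∀ {n} → (Seq n → Set) → ℕ → Set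
IsMinDelta M d = InDelta M d × (∀ e → InDelta M e → d ≤ e)

IsDivClosedSubmonoid : (n : ℕ) → (Seq n → Set) → Set
IsDivClosedSubmonoid n S =
  (∀ a → S a → Bpm n a) ×
  S 𝟙 ×
  (∀ a b → S a → S b → S (a · b)) ×
  (∀ a b → S a → Bpm n b → (∃ λ c → Bpm n c × b · c ≡ a) → S b)

InDeltaStar : (n : ℕ) → ℕ → Set₁
InDeltaStar n d =
  Σ (Seq n → Set) λ S → IsDivClosedSubmonoid n S × IsMinDelta S d

-- For g ≠ 0 in C_n, n an odd prime, a signing of g^j sums to (2A − j)·g with |2A − j| < n when
-- j < n, so such a g^j is a plus-minus zero-sum only for even j. Hence the zero-sum powers of g are
-- the g^(2u+vn), their atoms are g² and gⁿ, and g^(2n) = (gⁿ)² = (g²)ⁿ has lengths 2 and n.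
--
-- Δ*(H) ⊆ {1, n − 2}: take S divisor-closed with d = min Δ(S) realised by a ∈ S. If a contains some
-- g ≠ 0, then g^(2n) ∈ S, and multiplying g^(2n) by powers of a turns the length difference n − 2
-- into a gap of (n − 2) mod d, which must vanish; so d ∣ n − 2. If a contains only 0, all its
-- factorizations have the same length.
--
-- {1, n − 2} ⊆ Δ*(H): in H, (1²·2)² = (1²)²·2² has lengths 2 and 3. In B±({g}) a factorization into
-- u copies of g² and v copies of gⁿ has length u + v, so lengths k < l of one element satisfy
-- 2k + (n − 2)v = 2l + (n − 2)v′; the odd prime n − 2 then divides l − k, and g^(2n) attains it.

module Submission where

open import Defs

open import Level using (0ℓ)
open import Function using (_∘_)
open import Algebra.Bundles using (CommutativeMonoid)
import Algebra.Properties.CommutativeMonoid.Mult as Mult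
import Algebra.Properties.CommutativeSemigroup as CommutativeSemigroupProperties
open import Data.Empty using (⊥-elim)
open import Data.Product using (_×_; ∃; _,_; proj₁; proj₂; map₂)
open import Data.Sum using (_⊎_; inj₁; inj₂; [_,_])
import Data.Sum as Sum
open import Data.Nat
  using (ℕ; zero; suc; _+_; _*_; _∸_; _≤_; _<_; z≤n; s≤s; ∣_-_∣; NonZero; >-nonZero; nonTrivial⇒n>1)
import Data.Nat.Properties as ℕ
import Data.Nat.Tactic.RingSolver as ℕ-Solver
open import Data.Nat.Induction using (<-rec)
open import Data.Nat.DivMod using (_%_; _/_; m≡m%n+[m/n]*n; m%n<n)
open import Data.Nat.Divisibility using (_∣_; _∣0; _∣?_)
import Data.Nat.Divisibility as ℕ∣
open import Data.Nat.Primality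
  using (Prime; euclidsLemma; prime⇒nonTrivial; prime⇒irreducible; prime[2]; ¬prime[0]; ¬prime[1])
open import Data.Integer as ℤ using (ℤ; +_; ∣_∣)
import Data.Integer.Properties as ℤₚ
import Data.Integer.Divisibility.Signed as ℤ∣
import Data.Integer.Tactic.RingSolver as ℤ-Solver
open import Data.Fin as Fin using (Fin; toℕ; _≟_)
import Data.Fin.Properties as Finₚ
open import Data.Vec using (lookup; _[_]≔_; tabulate)
import Data.Vec.Properties as Vec
open import Data.List using (List; []; _∷_; length; foldr; _++_)
import Data.List.Properties as List
open import Data.List.Relation.Unary.All using (All; []; _∷_)
import Data.List.Relation.Unary.All.Properties as All
open import Relation.Nullary using (¬_; yes; no)
open import Relation.Nullary.Decidable using (decidable-stable; ¬?; _×-dec_)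
open import Relation.Binary.PropositionalEquality
  using (_≡_; _≢_; refl; sym; trans; cong; cong₂; subst; subst₂; module ≡-Reasoning)
open import Relation.Binary.PropositionalEquality.Algebra using (isMagma)

lookup-· : ∀ {n} (u v : Seq n) i → lookup (u · v) i ≡ lookup u i + lookup v i
lookup-· u v i = Vec.lookup-zipWith _+_ i u v

lookup-𝟙 : ∀ {n} (i : Fin n) → lookup (𝟙 {n}) i ≡ 0
lookup-𝟙 i = Vec.lookup-replicate i 0

Seq-ext : ∀ {n} {u v : Seq n} → (∀ i → lookup u i ≡ lookup v i) → u ≡ v
Seq-ext {u = u} {v} eq =
  trans (sym (Vec.tabulate∘lookup u)) (trans (Vec.tabulate-cong eq) (Vec.tabulate∘lookup v))

·-assoc : ∀ {n} (u v w : Seq n) → (u · v) · w ≡ u · (v · w)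
·-assoc = Vec.zipWith-assoc ℕ.+-assoc

·-comm : ∀ {n} (u v : Seq n) → u · v ≡ v · u
·-comm = Vec.zipWith-comm ℕ.+-comm

·-identityˡ : ∀ {n} (u : Seq n) → 𝟙 · u ≡ u
·-identityˡ = Vec.zipWith-identityˡ ℕ.+-identityˡ

·-identityʳ : ∀ {n} (u : Seq n) → u · 𝟙 ≡ u
·-identityʳ = Vec.zipWith-identityʳ ℕ.+-identityʳ

·-𝟙-commutativeMonoid : ℕ → CommutativeMonoid 0ℓ 0ℓ
·-𝟙-commutativeMonoid n = record
  { Carrier = Seq n
  ; _≈_ = _≡_
  ; _∙_ = _·_
  ; ε = 𝟙
  ; isCommutativeMonoid = record
    { isMonoid = record
      { isSemigroup = record { isMagma = isMagma _·_ ; assoc = ·-assoc }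
      ; identity = ·-identityˡ , ·-identityʳ
      }
    ; comm = ·-comm
    }
  }

module _ {n : ℕ} where
  open Mult (·-𝟙-commutativeMonoid n) public
    using () renaming (_×_ to _×ˢ_; ×-homo-+ to ×ˢ-homo-+; ×-distrib-+ to ×ˢ-distrib-·)
  open CommutativeSemigroupProperties (CommutativeMonoid.commutativeSemigroup (·-𝟙-commutativeMonoid n)) public
    using () renaming (interchange to ·-interchange)

prod : ∀ {n} → List (Seq n) → Seq n
prod = foldr _·_ 𝟙

prod-++ : ∀ {n} (us vs : List (Seq n)) → prod (us ++ vs) ≡ prod us · prod vs
prod-++ [] vs = sym (·-identityˡ _)
prod-++ (u ∷ us) vs = trans (cong (u ·_) (prod-++ us vs)) (sym (·-assoc u _ _))

lookup-factors : ∀ {n} {b c w : Seq n} → b · c ≡ w → ∀ k → lookup b k + lookup c k ≡ lookup w k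
lookup-factors {b = b} {c} refl k = sym (lookup-· b c k)

divisor-lookup-0 : ∀ {n} {b c w : Seq n} k → b · c ≡ w → lookup w k ≡ 0 → lookup b k ≡ 0
divisor-lookup-0 {b = b} k bc≡w w≡0 = ℕ.m+n≡0⇒m≡0 (lookup b k) (trans (lookup-factors bc≡w k) w≡0)

single : ∀ {n} → Fin n → ℕ → Seq n
single i j = 𝟙 [ i ]≔ j

lookup-single : ∀ {n} (i : Fin n) j → lookup (single i j) i ≡ j
lookup-single i j = Vec.lookup∘update i 𝟙 j

lookup-single-≢ : ∀ {n} {i k : Fin n} j → k ≢ i → lookup (single i j) k ≡ 0
lookup-single-≢ {k = k} j k≢i = trans (Vec.lookup∘update′ k≢i 𝟙 j) (lookup-𝟙 k)

≡single : ∀ {n} {v : Seq n} i → (∀ k → k ≢ i → lookup v k ≡ 0) → v ≡ single i (lookup v i)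
≡single {v = v} i v≡0 = Seq-ext at
  where
  at : ∀ k → lookup v k ≡ lookup (single i (lookup v i)) k
  at k with k ≟ i
  ... | yes refl = sym (lookup-single i (lookup v i))
  ... | no k≢i = trans (v≡0 k k≢i) (sym (lookup-single-≢ (lookup v i) k≢i))

single-0 : ∀ {n} (i : Fin n) → single i 0 ≡ 𝟙
single-0 i = trans (cong (𝟙 [ i ]≔_) (sym (lookup-𝟙 i))) (Vec.[]≔-lookup 𝟙 i)

single-injective : ∀ {n} (i : Fin n) {p q} → single i p ≡ single i q → p ≡ q
single-injective i {p} {q} eq =
  trans (sym (lookup-single i p)) (trans (cong (λ v → lookup v i) eq) (lookup-single i q))

single≢𝟙 : ∀ {n} (i : Fin n) {j} → j ≢ 0 → single i j ≢ 𝟙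
single≢𝟙 i j≢0 eq = j≢0 (single-injective i (trans eq (sym (single-0 i))))

single-+ : ∀ {n} (i : Fin n) p q → single i p · single i q ≡ single i (p + q)
single-+ i p q = trans (≡single i vanishes) (cong (single i) at-i)
  where
  at-i : lookup (single i p · single i q) i ≡ p + q
  at-i = trans (lookup-· (single i p) (single i q) i) (cong₂ _+_ (lookup-single i p) (lookup-single i q))
  vanishes : ∀ k → k ≢ i → lookup (single i p · single i q) k ≡ 0
  vanishes k k≢i = trans (lookup-· (single i p) (single i q) k)
    (cong₂ _+_ (lookup-single-≢ p k≢i) (lookup-single-≢ q k≢i))

divisor-single : ∀ {n} {b c : Seq n} i {j} → b · c ≡ single i j → b ≡ single i (lookup b i)
divisor-single i bc≡ = ≡single i λ k k≢i → divisor-lookup-0 k bc≡ (lookup-single-≢ _ k≢i)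

×ˢ-single : ∀ {n} (i : Fin n) m j → m ×ˢ single i j ≡ single i (m * j)
×ˢ-single i zero j = sym (single-0 i)
×ˢ-single i (suc m) j = trans (cong (single i j ·_) (×ˢ-single i m j)) (single-+ i j (m * j))

single-divides : ∀ {n} {a : Seq n} i → lookup a i ≢ 0 → ∃ λ a′ → a ≡ single i 1 · a′
single-divides {a = a} i aᵢ≢0 = a′ , Seq-ext at
  where
  a′ = tabulate (λ k → lookup a k ∸ lookup (single i 1) k)
  single≤a : ∀ k → lookup (single i 1) k ≤ lookup a k
  single≤a k with k ≟ i
  ... | yes refl = subst (_≤ lookup a i) (sym (lookup-single i 1)) (ℕ.n≢0⇒n>0 aᵢ≢0)
  ... | no k≢i = subst (_≤ lookup a k) (sym (lookup-single-≢ 1 k≢i)) z≤n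
  at : ∀ k → lookup a k ≡ lookup (single i 1 · a′) k
  at k = sym (trans (lookup-· (single i 1) a′ k)
    (trans (cong (_+_ (lookup (single i 1) k)) (Vec.lookup∘tabulate _ k)) (ℕ.m+[n∸m]≡n (single≤a k))))

-- Plus-minus weighted zero-sum sequences

ΣFin-cong : ∀ {n} {f g : Fin n → ℤ} → (∀ i → f i ≡ g i) → ΣFin f ≡ ΣFin g
ΣFin-cong {zero} f≡g = refl
ΣFin-cong {suc n} f≡g = cong₂ ℤ._+_ (f≡g Fin.zero) (ΣFin-cong (λ i → f≡g (Fin.suc i)))

ΣFin-+ : ∀ {n} (f g : Fin n → ℤ) → ΣFin (λ i → f i ℤ.+ g i) ≡ ΣFin f ℤ.+ ΣFin g
ΣFin-+ {zero} f g = refl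
ΣFin-+ {suc n} f g = trans (cong (ℤ._+_ (f Fin.zero ℤ.+ g Fin.zero)) (ΣFin-+ (f ∘ Fin.suc) (g ∘ Fin.suc)))
  (interchange (f Fin.zero) (g Fin.zero) (ΣFin (f ∘ Fin.suc)) (ΣFin (g ∘ Fin.suc)))
  where
  interchange : ∀ a b c d → (a ℤ.+ b) ℤ.+ (c ℤ.+ d) ≡ (a ℤ.+ c) ℤ.+ (b ℤ.+ d)
  interchange = ℤ-Solver.solve-∀

ΣFin-zero : ∀ {n} {f : Fin n → ℤ} → (∀ i → f i ≡ + 0) → ΣFin f ≡ + 0
ΣFin-zero {zero} f≡0 = refl
ΣFin-zero {suc n} f≡0 = cong₂ ℤ._+_ (f≡0 Fin.zero) (ΣFin-zero (λ i → f≡0 (Fin.suc i)))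

ΣFin-concentrated : ∀ {n} {f : Fin n → ℤ} i → (∀ k → k ≢ i → f k ≡ + 0) → ΣFin f ≡ f i
ΣFin-concentrated {suc n} {f} Fin.zero f≡0 =
  trans (cong (ℤ._+_ (f Fin.zero)) (ΣFin-zero λ k → f≡0 (Fin.suc k) λ ())) (ℤₚ.+-identityʳ (f Fin.zero))
ΣFin-concentrated {suc n} {f} (Fin.suc i) f≡0 =
  trans (cong (ℤ._+ ΣFin (f ∘ Fin.suc)) (f≡0 Fin.zero λ ())) (trans (ℤₚ.+-identityˡ _)
    (ΣFin-concentrated i λ k k≢i → f≡0 (Fin.suc k) (k≢i ∘ Finₚ.suc-injective)))

signedTerm : ∀ {n} → Seq n → Seq n → Fin n → ℤ
signedTerm v a i = (+ lookup a i ℤ.- + (lookup v i ∸ lookup a i)) ℤ.* + toℕ i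

_≤ˢ_ : ∀ {n} → Seq n → Seq n → Set
a ≤ˢ v = ∀ i → lookup a i ≤ lookup v i

Bpm-signedSum≡0 : ∀ {n} {v : Seq n} a → a ≤ˢ v → ΣFin (signedTerm v a) ≡ + 0 → Bpm n v
Bpm-signedSum≡0 {n} a a≤v Σ≡0 = a , a≤v , subst (λ z → n ∣ ∣ z ∣) (sym Σ≡0) (n ∣0)

[+a]-[+x∸a] : ∀ {a x} → a ≤ x → + a ℤ.- + (x ∸ a) ≡ (+ a ℤ.+ + a) ℤ.- + x
[+a]-[+x∸a] {a} {x} a≤x = begin
  + a ℤ.- + (x ∸ a)            ≡⟨ cong (λ z → + a ℤ.- z) +[x∸a]≡+x-+a ⟩
  + a ℤ.- (+ x ℤ.- + a)        ≡⟨ rearrange (+ a) (+ x) ⟩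
  (+ a ℤ.+ + a) ℤ.- + x        ∎
  where
  open ≡-Reasoning
  +[x∸a]≡+x-+a : + (x ∸ a) ≡ + x ℤ.- + a
  +[x∸a]≡+x-+a = sym (trans (ℤₚ.[+m]-[+n]≡m⊖n x a) (ℤₚ.⊖-≥ a≤x))
  rearrange : ∀ a x → a ℤ.- (x ℤ.- a) ≡ (a ℤ.+ a) ℤ.- x
  rearrange = ℤ-Solver.solve-∀

signedTerm-· : ∀ {n} {u v a b : Seq n} i → lookup a i ≤ lookup u i → lookup b i ≤ lookup v i →
  signedTerm (u · v) (a · b) i ≡ signedTerm u a i ℤ.+ signedTerm v b i
signedTerm-· {u = u} {v} {a} {b} i aᵢ≤uᵢ bᵢ≤vᵢ
  rewrite lookup-· u v i | lookup-· a b i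
        | [+a]-[+x∸a] (ℕ.+-mono-≤ aᵢ≤uᵢ bᵢ≤vᵢ) | [+a]-[+x∸a] aᵢ≤uᵢ | [+a]-[+x∸a] bᵢ≤vᵢ
        | ℤₚ.pos-+ (lookup a i) (lookup b i) | ℤₚ.pos-+ (lookup u i) (lookup v i)
  = distribute (+ lookup a i) (+ lookup b i) (+ lookup u i) (+ lookup v i) (+ toℕ i)
  where
  distribute : ∀ a b u v t →
    (((a ℤ.+ b) ℤ.+ (a ℤ.+ b)) ℤ.- (u ℤ.+ v)) ℤ.* t ≡
    ((a ℤ.+ a) ℤ.- u) ℤ.* t ℤ.+ ((b ℤ.+ b) ℤ.- v) ℤ.* t
  distribute = ℤ-Solver.solve-∀

·-mono-≤ˢ : ∀ {n} {a b u v : Seq n} → a ≤ˢ u → b ≤ˢ v → (a · b) ≤ˢ (u · v)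
·-mono-≤ˢ {a = a} {b} {u} {v} a≤u b≤v i =
  subst₂ _≤_ (sym (lookup-· a b i)) (sym (lookup-· u v i)) (ℕ.+-mono-≤ (a≤u i) (b≤v i))

signedSum-· : ∀ {n} {u v a b : Seq n} → a ≤ˢ u → b ≤ˢ v →
  ΣFin (signedTerm (u · v) (a · b)) ≡ ΣFin (signedTerm u a) ℤ.+ ΣFin (signedTerm v b)
signedSum-· {u = u} {v} {a} {b} a≤u b≤v =
  trans (ΣFin-cong (λ i → signedTerm-· {u = u} {v} {a} {b} i (a≤u i) (b≤v i)))
        (ΣFin-+ (signedTerm u a) (signedTerm v b))

Bpm-· : ∀ {n} {u v : Seq n} → Bpm n u → Bpm n v → Bpm n (u · v)
Bpm-· {n} {u} {v} (a , a≤u , n∣Σa) (b , b≤v , n∣Σb) = a · b , ·-mono-≤ˢ {a = a} {b} {u} {v} a≤u b≤v ,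
  ℤ∣.∣⇒∣ᵤ (subst (ℤ∣._∣_ (+ n)) (sym (signedSum-· {u = u} {v} {a} {b} a≤u b≤v))
    (ℤ∣.∣m∣n⇒∣m+n (ℤ∣.∣ᵤ⇒∣ {i = ΣFin (signedTerm u a)} n∣Σa)
                  (ℤ∣.∣ᵤ⇒∣ {i = ΣFin (signedTerm v b)} n∣Σb)))

Bpm-square : ∀ {n} (v : Seq n) → Bpm n (v · v)
Bpm-square v = Bpm-signedSum≡0 {v = v · v} v v≤vv (ΣFin-zero balanced)
  where
  v≤vv : v ≤ˢ (v · v)
  v≤vv i = subst (lookup v i ≤_) (sym (lookup-· v v i)) (ℕ.m≤m+n _ _)
  balanced : ∀ i → signedTerm (v · v) v i ≡ + 0
  balanced i rewrite [+a]-[+x∸a] (v≤vv i) | lookup-· v v i | ℤₚ.pos-+ (lookup v i) (lookup v i)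
    | ℤₚ.+-inverseʳ (+ lookup v i ℤ.+ + lookup v i) = refl

Bpm-𝟙 : ∀ {n} → Bpm n 𝟙
Bpm-𝟙 {n} = subst (Bpm n) (·-identityˡ 𝟙) (Bpm-square 𝟙)

≤ˢsingle : ∀ {n} {a : Seq n} {i j} → a ≤ˢ single i j → a ≡ single i (lookup a i)
≤ˢsingle {a = a} {i} {j} a≤ =
  ≡single i λ k k≢i → ℕ.n≤0⇒n≡0 (subst (lookup a k ≤_) (lookup-single-≢ j k≢i) (a≤ k))

single-mono-≤ˢ : ∀ {n} (i : Fin n) {p q} → p ≤ q → single i p ≤ˢ single i q
single-mono-≤ˢ i {p} {q} p≤q k with k ≟ i
... | yes refl = subst₂ _≤_ (sym (lookup-single i p)) (sym (lookup-single i q)) p≤q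
... | no k≢i = subst₂ _≤_ (sym (lookup-single-≢ p k≢i)) (sym (lookup-single-≢ q k≢i)) z≤n

signedSum-single : ∀ {n} (i : Fin n) j a →
  ΣFin (signedTerm (single i j) (single i a)) ≡ (+ a ℤ.- + (j ∸ a)) ℤ.* + toℕ i
signedSum-single i j a = trans (ΣFin-concentrated i vanishes) at-i
  where
  vanishes : ∀ k → k ≢ i → signedTerm (single i j) (single i a) k ≡ + 0
  vanishes k k≢i rewrite lookup-single-≢ j k≢i | lookup-single-≢ a k≢i = refl
  at-i : signedTerm (single i j) (single i a) i ≡ (+ a ℤ.- + (j ∸ a)) ℤ.* + toℕ i
  at-i rewrite lookup-single i j | lookup-single i a = refl

Bpm-single : ∀ {n} (i : Fin n) j → n ∣ j * toℕ i → Bpm n (single i j)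
Bpm-single {n} i j n∣jt =
  single i j , (λ _ → ℕ.≤-refl) , subst (λ z → n ∣ ∣ z ∣) (sym (signedSum-single i j j)) n∣
  where
  n∣ : n ∣ ∣ (+ j ℤ.- + (j ∸ j)) ℤ.* + toℕ i ∣
  n∣ rewrite ℕ.n∸n≡0 j | ℕ.+-identityʳ j = subst (n ∣_) (sym (ℤₚ.abs-* (+ j) (+ toℕ i))) n∣jt

∣[+m]-[+n]∣≡∣m-n∣ : ∀ m n → ∣ + m ℤ.- + n ∣ ≡ ∣ m - n ∣
∣[+m]-[+n]∣≡∣m-n∣ zero zero = refl
∣[+m]-[+n]∣≡∣m-n∣ zero (suc n) = refl
∣[+m]-[+n]∣≡∣m-n∣ (suc m) zero = ℕ.+-identityʳ (suc m)
∣[+m]-[+n]∣≡∣m-n∣ (suc m) (suc n) =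
  trans (cong ∣_∣ (trans (ℤₚ.[1+m]⊖[1+n]≡m⊖n m n) (sym (ℤₚ.[+m]-[+n]≡m⊖n m n))))
        (∣[+m]-[+n]∣≡∣m-n∣ m n)

∣∧<⇒≡0 : ∀ {m n} → n ∣ m → m < n → m ≡ 0
∣∧<⇒≡0 {zero} n∣m m<n = refl
∣∧<⇒≡0 {suc m} n∣m m<n = ⊥-elim (ℕ∣.>⇒∤ m<n n∣m)

Bpm-single⇒even : ∀ {n} → Prime n → (i : Fin n) → toℕ i ≢ 0 →
  ∀ {j} → j < n → Bpm n (single i j) → ∃ λ u → j ≡ 2 * u
Bpm-single⇒even {n} n-prime i i≢0 {j} j<n (a , a≤ , n∣Σ) = A , j≡2A
  where
  A = lookup a i
  A≤j : A ≤ j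
  A≤j = subst (A ≤_) (lookup-single i j) (a≤ i)
  Σ≡ : ∣ ΣFin (signedTerm (single i j) a) ∣ ≡ ∣ A - (j ∸ A) ∣ * toℕ i
  Σ≡ = begin
    ∣ ΣFin (signedTerm (single i j) a) ∣
      ≡⟨ cong (λ b → ∣ ΣFin (signedTerm (single i j) b) ∣) (≤ˢsingle {a = a} a≤) ⟩
    ∣ ΣFin (signedTerm (single i j) (single i A)) ∣
      ≡⟨ cong ∣_∣ (signedSum-single i j A) ⟩
    ∣ (+ A ℤ.- + (j ∸ A)) ℤ.* + toℕ i ∣
      ≡⟨ ℤₚ.abs-* (+ A ℤ.- + (j ∸ A)) (+ toℕ i) ⟩
    ∣ + A ℤ.- + (j ∸ A) ∣ * toℕ i
      ≡⟨ cong (_* toℕ i) (∣[+m]-[+n]∣≡∣m-n∣ A (j ∸ A)) ⟩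
    ∣ A - (j ∸ A) ∣ * toℕ i
      ∎
    where open ≡-Reasoning
  A≡j∸A : A ≡ j ∸ A
  A≡j∸A with euclidsLemma ∣ A - (j ∸ A) ∣ (toℕ i) n-prime (subst (n ∣_) Σ≡ n∣Σ)
  ... | inj₁ n∣A-[j∸A] =
    ℕ.∣m-n∣≡0⇒m≡n (∣∧<⇒≡0 n∣A-[j∸A] (ℕ.≤-<-trans (ℕ.∣m-n∣≤m⊔n A (j ∸ A)) ⊔<n))
    where ⊔<n = ℕ.⊔-lub (ℕ.≤-<-trans A≤j j<n) (ℕ.≤-<-trans (ℕ.m∸n≤m j A) j<n)
  ... | inj₂ n∣i = ⊥-elim (i≢0 (∣∧<⇒≡0 n∣i (Finₚ.toℕ<n i)))
  j≡2A : j ≡ 2 * A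
  j≡2A = begin
    j             ≡⟨ ℕ.m+[n∸m]≡n A≤j ⟨
    A + (j ∸ A)   ≡⟨ cong (_+_ A) A≡j∸A ⟨
    A + A         ≡⟨ cong (_+_ A) (ℕ.+-identityʳ A) ⟨
    2 * A         ∎
    where open ≡-Reasoning

Bpm-single-double : ∀ {n} (i : Fin n) m → Bpm n (single i (m + m))
Bpm-single-double {n} i m = subst (Bpm n) (single-+ i m m) (Bpm-square (single i m))

Bpm-single-zero : ∀ {n} j → Bpm (suc n) (single Fin.zero j)
Bpm-single-zero {n} j = Bpm-single Fin.zero j (subst (suc n ∣_) (sym (ℕ.*-zeroʳ j)) (suc n ∣0))

-- Factorization lengths

module _ {n} (M : Seq n → Set) where

  HasLength-𝟙 : HasLength M 𝟙 0
  HasLength-𝟙 = [] , refl , [] , refl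

  HasLength-atom : ∀ {a} → IsAtom M a → HasLength M a 1
  HasLength-atom {a} a-atom = a ∷ [] , refl , a-atom ∷ [] , ·-identityʳ a

  HasLength-· : ∀ {u v p q} → HasLength M u p → HasLength M v q → HasLength M (u · v) (p + q)
  HasLength-· (us , refl , us-atoms , refl) (vs , refl , vs-atoms , refl) =
    us ++ vs , List.length-++ us , All.++⁺ us-atoms vs-atoms , prod-++ us vs

  HasLength-×ˢ : ∀ {a l} → HasLength M a l → ∀ q → HasLength M (q ×ˢ a) (q * l)
  HasLength-×ˢ a-l zero = HasLength-𝟙
  HasLength-×ˢ a-l (suc q) = HasLength-· a-l (HasLength-×ˢ a-l q)

  -- Constructive substitute for "take two consecutive lengths between L and L + r":
  -- the gap r contains some element of Δ(M), up to double negation.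
  lengthGap⇒¬¬Δ≤ : ∀ {y} → M y → ∀ {L} r → 0 < r → HasLength M y L → HasLength M y (L + r) →
    ¬ ¬ (∃ λ e → e ≤ r × InDelta M e)
  lengthGap⇒¬¬Δ≤ {y} M-y {L} = <-rec Gap step
    where
    Gap : ℕ → Set
    Gap r = 0 < r → HasLength M y L → HasLength M y (L + r) → ¬ ¬ (∃ λ e → e ≤ r × InDelta M e)
    step : ∀ r → (∀ {r′} → r′ < r → Gap r′) → Gap r
    step r smaller 0<r y-L y-L+r no-Δ≤r =
      no-Δ≤r (r , ℕ.≤-refl ,
        y , M-y , L , L + r , y-L , y-L+r , ℕ.m<m+n L 0<r , sym (ℕ.m+n∸m≡n L r) , consecutive)
      where
      consecutive : ∀ m → HasLength M y m → ¬ (L < m × m < L + r)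
      consecutive m y-m (L<m , m<L+r) =
        smaller r′<r 0<r′ y-L (subst (HasLength M y) (sym L+r′≡m) y-m)
          λ (e , e≤r′ , Δe) → no-Δ≤r (e , ℕ.≤-trans e≤r′ (ℕ.<⇒≤ r′<r) , Δe)
        where
        r′ = m ∸ L
        L+r′≡m : L + r′ ≡ m
        L+r′≡m = ℕ.m+[n∸m]≡n (ℕ.<⇒≤ L<m)
        r′<r : r′ < r
        r′<r = ℕ.+-cancelˡ-< L r′ r (subst (_< L + r) (sym L+r′≡m) m<L+r)
        0<r′ : 0 < r′
        0<r′ = ℕ.m<n⇒0<n∸m L<m

-- Divisor-closed submonoids

Bpm-divisorClosed : ∀ {n} → IsDivClosedSubmonoid n (Bpm n)
Bpm-divisorClosed = (λ _ Bpm-a → Bpm-a) , Bpm-𝟙 , (λ a b → Bpm-· {u = a} {b}) , (λ _ _ _ Bpm-b _ → Bpm-b)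

module DivisorClosed {n} {M : Seq n → Set} (M-dc : IsDivClosedSubmonoid n M) where

  M⊆Bpm : ∀ {a} → M a → Bpm n a
  M⊆Bpm = proj₁ M-dc _

  M-𝟙 : M 𝟙
  M-𝟙 = proj₁ (proj₂ M-dc)

  M-· : ∀ {a b} → M a → M b → M (a · b)
  M-· = proj₁ (proj₂ (proj₂ M-dc)) _ _

  M-divisor : ∀ {a b c} → M a → Bpm n b → Bpm n c → b · c ≡ a → M b
  M-divisor M-a Bpm-b Bpm-c bc≡a = proj₂ (proj₂ (proj₂ M-dc)) _ _ M-a Bpm-b (_ , Bpm-c , bc≡a)

  M-×ˢ : ∀ {a} → M a → ∀ q → M (q ×ˢ a)
  M-×ˢ M-a zero = M-𝟙
  M-×ˢ M-a (suc q) = M-· M-a (M-×ˢ M-a q)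

ZeroSupported : ∀ {n} → Seq (suc n) → Set
ZeroSupported v = ∀ k → k ≢ Fin.zero → lookup v k ≡ 0

module _ {n} {M : Seq (suc n) → Set} (M-dc : IsDivClosedSubmonoid (suc n) M) where
  open DivisorClosed M-dc

  private
    0ᶠ : Fin (suc n)
    0ᶠ = Fin.zero

  atom-at-zero : ∀ {b} → IsAtom M b → ZeroSupported b → lookup b 0ᶠ ≡ 1
  atom-at-zero {b} (M-b , b≢𝟙 , indecomposable) b-supp with lookup b 0ᶠ in b₀≡
  ... | zero = ⊥-elim (b≢𝟙 (trans b≡ (single-0 0ᶠ)))
    where b≡ = trans (≡single 0ᶠ b-supp) (cong (single 0ᶠ) b₀≡)
  ... | suc zero = refl
  ... | suc (suc m) with indecomposable (single 0ᶠ 1) (single 0ᶠ (suc m))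
                           (M-divisor M-b (Bpm-single-zero 1) (Bpm-single-zero (suc m)) (sym b≡))
                           (M-divisor M-b (Bpm-single-zero (suc m)) (Bpm-single-zero 1)
                             (trans (·-comm (single 0ᶠ (suc m)) (single 0ᶠ 1)) (sym b≡)))
                           b≡
    where b≡ = trans (≡single 0ᶠ b-supp) (trans (cong (single 0ᶠ) b₀≡) (sym (single-+ 0ᶠ 1 (suc m))))
  ...   | inj₁ 1≡𝟙 = ⊥-elim (single≢𝟙 0ᶠ (λ ()) 1≡𝟙)
  ...   | inj₂ 1+m≡𝟙 = ⊥-elim (single≢𝟙 0ᶠ (λ ()) 1+m≡𝟙)

  length-zero-supported : ∀ {a k} → ZeroSupported a → HasLength M a k → k ≡ lookup a 0ᶠ
  length-zero-supported a-supp (bs , refl , bs-atoms , refl) = count bs bs-atoms a-supp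
    where
    count : ∀ bs → All (IsAtom M) bs → ZeroSupported (prod bs) → length bs ≡ lookup (prod bs) 0ᶠ
    count [] [] _ = sym (lookup-𝟙 0ᶠ)
    count (b ∷ bs) (b-atom ∷ bs-atoms) supp = begin
      suc (length bs)
        ≡⟨ cong₂ _+_ (sym (atom-at-zero b-atom b-supp)) (count bs bs-atoms bs-supp) ⟩
      lookup b 0ᶠ + lookup (prod bs) 0ᶠ
        ≡⟨ lookup-· b (prod bs) 0ᶠ ⟨
      lookup (prod (b ∷ bs)) 0ᶠ
        ∎
      where
      open ≡-Reasoning
      b-supp : ZeroSupported b
      b-supp k k≢0 = divisor-lookup-0 {b = b} {prod bs} k refl (supp k k≢0)
      bs-supp : ZeroSupported (prod bs)
      bs-supp k k≢0 = divisor-lookup-0 k (·-comm (prod bs) b) (supp k k≢0)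

even⊎odd : ∀ m → (∃ λ u → m ≡ 2 * u) ⊎ (∃ λ u → m ≡ suc (2 * u))
even⊎odd zero = inj₁ (0 , refl)
even⊎odd (suc m) with even⊎odd m
... | inj₁ (u , refl) = inj₂ (u , refl)
... | inj₂ (u , refl) = inj₁ (suc u , cong suc (sym (ℕ.+-suc u (u + 0))))

2k+cv≡2l+cv′⇒c∣l∸k : ∀ {c k l v v′} → Prime c → c ≢ 2 →
  2 * k + c * v ≡ 2 * l + c * v′ → c ∣ l ∸ k
2k+cv≡2l+cv′⇒c∣l∸k {c} {k} {l} {v} {v′} c-prime c≢2 eq
  with euclidsLemma 2 (l ∸ k) c-prime (subst (c ∣_) (sym 2[l∸k]≡c[v∸v′]) (ℕ∣.m∣m*n (v ∸ v′)))
  where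
  open ≡-Reasoning
  -- Valid with truncated subtraction, so no case split on k ≤ l or v′ ≤ v is needed.
  2[l∸k]≡c[v∸v′] : 2 * (l ∸ k) ≡ c * (v ∸ v′)
  2[l∸k]≡c[v∸v′] = begin
    2 * (l ∸ k)                           ≡⟨ ℕ.*-distribˡ-∸ 2 l k ⟩
    2 * l ∸ 2 * k                         ≡⟨ ℕ.[m+n]∸[m+o]≡n∸o (c * v′) (2 * l) (2 * k) ⟨
    (c * v′ + 2 * l) ∸ (c * v′ + 2 * k)   ≡⟨ cong₂ _∸_ (trans (ℕ.+-comm (c * v′) (2 * l)) (sym eq))
                                                        (ℕ.+-comm (c * v′) (2 * k)) ⟩
    (2 * k + c * v) ∸ (2 * k + c * v′)    ≡⟨ ℕ.[m+n]∸[m+o]≡n∸o (2 * k) (c * v) (c * v′) ⟩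
    c * v ∸ c * v′                        ≡⟨ ℕ.*-distribˡ-∸ c v v′ ⟨
    c * (v ∸ v′)                          ∎
... | inj₂ c∣l∸k = c∣l∸k
... | inj₁ c∣2 =
  ⊥-elim ([ (λ c≡1 → ¬prime[1] (subst Prime c≡1 c-prime)) , c≢2 ] (prime⇒irreducible prime[2] c∣2))

-- B±(C_n) for an odd prime n

module OddPrime {h : ℕ} (n-prime : Prime (suc (2 * h))) where

  n : ℕ
  n = suc (2 * h)

  1<n : 1 < n
  1<n = nonTrivial⇒n>1 n {{prime⇒nonTrivial n-prime}}

  2<n : 2 < n
  2<n = ℕ.≤∧≢⇒< 1<n (ℕ.even≢odd 1 h)

  n∸2≢2 : n ∸ 2 ≢ 2
  n∸2≢2 n∸2≡2 = ℕ.even≢odd 2 h (trans (cong (_+_ 2) (sym n∸2≡2)) (ℕ.m+[n∸m]≡n 1<n))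

  odd≥n⇒2w+n : ∀ {j u} → j ≡ suc (2 * u) → n ≤ j → ∃ λ w → j ≡ 2 * w + 1 * n
  odd≥n⇒2w+n {j} {u} j≡1+2u n≤j with even⊎odd (j ∸ n)
  ... | inj₁ (w , j∸n≡2w) = w , trans j≡n+[j∸n] (trans (cong (_+_ n) j∸n≡2w) (swap n (2 * w)))
    where
    j≡n+[j∸n] = sym (ℕ.m+[n∸m]≡n n≤j)
    swap : ∀ a b → a + b ≡ b + 1 * a
    swap = ℕ-Solver.solve-∀
  ... | inj₂ (w , j∸n≡1+2w) = ⊥-elim (ℕ.even≢odd (suc (h + w)) u (begin
    2 * suc (h + w)          ≡⟨ odd+odd h w ⟩
    n + suc (2 * w)          ≡⟨ cong (_+_ n) j∸n≡1+2w ⟨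
    n + (j ∸ n)              ≡⟨ ℕ.m+[n∸m]≡n n≤j ⟩
    j                        ≡⟨ j≡1+2u ⟩
    suc (2 * u)              ∎))
    where
    open ≡-Reasoning
    odd+odd : ∀ h w → 2 * suc (h + w) ≡ suc (2 * h) + suc (2 * w)
    odd+odd = ℕ-Solver.solve-∀

  Bpm-single-n : ∀ (i : Fin n) → Bpm n (single i n)
  Bpm-single-n i = Bpm-single i n (ℕ∣.m∣m*n (toℕ i))

  ¬Bpm-single-odd : ∀ {i : Fin n} → toℕ i ≢ 0 → ∀ {j} → j < n → ∀ u → j ≡ suc (2 * u) →
    ¬ Bpm n (single i j)
  ¬Bpm-single-odd {i} i≢0 j<n u j-odd Bpm-ij with Bpm-single⇒even n-prime i i≢0 j<n Bpm-ij
  ... | v , j-even = ℕ.even≢odd v u (trans (sym j-even) j-odd)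

  -- i² and iⁿ split into no two nonempty zero-sum powers of i: one part would be odd and < n.
  single-2∨n-split : ∀ {i : Fin n} → toℕ i ≢ 0 → ∀ {p q} → p + q ≡ 2 ⊎ p + q ≡ n →
    Bpm n (single i p) → Bpm n (single i q) → p ≡ 0 ⊎ q ≡ 0
  single-2∨n-split i≢0 {zero} _ _ _ = inj₁ refl
  single-2∨n-split i≢0 {suc p} {zero} _ _ _ = inj₂ refl
  single-2∨n-split i≢0 {suc zero} {suc q} (inj₁ _) Bpm-p _ =
    ⊥-elim (¬Bpm-single-odd i≢0 1<n 0 refl Bpm-p)
  single-2∨n-split i≢0 {suc (suc p)} {suc q} (inj₁ p+q≡2) _ _ =
    ⊥-elim (ℕ.m+1+n≢0 p (ℕ.suc-injective (ℕ.suc-injective p+q≡2)))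
  single-2∨n-split i≢0 {p@(suc _)} {q@(suc _)} (inj₂ p+q≡n) Bpm-p Bpm-q with even⊎odd p | even⊎odd q
  ... | inj₂ (u , p-odd) | _ = ⊥-elim (¬Bpm-single-odd i≢0 p<n u p-odd Bpm-p)
    where p<n = subst (p <_) p+q≡n (ℕ.m<m+n p (s≤s z≤n))
  ... | inj₁ _ | inj₂ (v , q-odd) = ⊥-elim (¬Bpm-single-odd i≢0 q<n v q-odd Bpm-q)
    where q<n = subst (q <_) p+q≡n (ℕ.m<n+m q (s≤s z≤n))
  ... | inj₁ (u , p-even) | inj₁ (v , q-even) =
    ⊥-elim (ℕ.even≢odd (u + v) h
      (trans (ℕ.*-distribˡ-+ 2 u v) (trans (sym (cong₂ _+_ p-even q-even)) p+q≡n)))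

  single-atom : ∀ {M : Seq n → Set} → (∀ {a} → M a → Bpm n a) → ∀ {i} → toℕ i ≢ 0 →
    ∀ {j} → j ≡ 2 ⊎ j ≡ n → M (single i j) → IsAtom M (single i j)
  single-atom {M} M⊆Bpm {i} i≢0 {j} j∈2,n M-ij = M-ij , single≢𝟙 i j≢0 , indecomposable
    where
    j≢0 : j ≢ 0
    j≢0 = [ (λ { refl () }) , (λ { refl () }) ] j∈2,n
    indecomposable : ∀ b c → M b → M c → single i j ≡ b · c → b ≡ 𝟙 ⊎ c ≡ 𝟙
    indecomposable b c M-b M-c ij≡bc =
      Sum.map (λ bᵢ≡0 → trans b≡ (trans (cong (single i) bᵢ≡0) (single-0 i)))
              (λ cᵢ≡0 → trans c≡ (trans (cong (single i) cᵢ≡0) (single-0 i)))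
              (single-2∨n-split i≢0 (subst (λ m → m ≡ 2 ⊎ m ≡ n) (sym bᵢ+cᵢ≡j) j∈2,n)
                 (subst (Bpm n) b≡ (M⊆Bpm M-b)) (subst (Bpm n) c≡ (M⊆Bpm M-c)))
      where
      b≡ : b ≡ single i (lookup b i)
      b≡ = divisor-single i (sym ij≡bc)
      c≡ : c ≡ single i (lookup c i)
      c≡ = divisor-single i (trans (·-comm c b) (sym ij≡bc))
      bᵢ+cᵢ≡j : lookup b i + lookup c i ≡ j
      bᵢ+cᵢ≡j = trans (lookup-factors (sym ij≡bc) i) (lookup-single i j)

  module Power2n {M : Seq n → Set} (M-dc : IsDivClosedSubmonoid n M)
                 {i : Fin n} (i≢0 : toℕ i ≢ 0) where
    open DivisorClosed M-dc

    i²ⁿ : Seq n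
    i²ⁿ = single i (n + n)

    -- i²ⁿ divides a^(2n) with the square cofactor (a′ⁿ)², where a = i · a′.
    i²ⁿ∈M : ∀ {a} → M a → lookup a i ≢ 0 → M i²ⁿ
    i²ⁿ∈M {a} M-a aᵢ≢0 with single-divides i aᵢ≢0
    ... | a′ , a≡ia′ = M-divisor (M-×ˢ M-a (n + n)) (Bpm-single-double i n) Bpm-cofactor (sym power≡)
      where
      Bpm-cofactor : Bpm n ((n + n) ×ˢ a′)
      Bpm-cofactor = subst (Bpm n) (sym (×ˢ-homo-+ a′ n n)) (Bpm-square (n ×ˢ a′))
      power≡ : (n + n) ×ˢ a ≡ i²ⁿ · ((n + n) ×ˢ a′)
      power≡ = begin
        (n + n) ×ˢ a
          ≡⟨ cong ((n + n) ×ˢ_) a≡ia′ ⟩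
        (n + n) ×ˢ (single i 1 · a′)
          ≡⟨ ×ˢ-distrib-· (single i 1) a′ (n + n) ⟩
        ((n + n) ×ˢ single i 1) · ((n + n) ×ˢ a′)
          ≡⟨ cong (_· ((n + n) ×ˢ a′)) (×ˢ-single i (n + n) 1) ⟩
        single i ((n + n) * 1) · ((n + n) ×ˢ a′)
          ≡⟨ cong (λ m → single i m · ((n + n) ×ˢ a′)) (ℕ.*-identityʳ (n + n)) ⟩
        i²ⁿ · ((n + n) ×ˢ a′)
          ∎
        where open ≡-Reasoning

    module _ (M-i²ⁿ : M i²ⁿ) where

      atom-i² : IsAtom M (single i 2)
      atom-i² = single-atom M⊆Bpm i≢0 (inj₁ refl)
        (M-divisor M-i²ⁿ (Bpm-single-double i 1) (Bpm-single-double i (2 * h)) i²·i⁴ʰ≡i²ⁿ)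
        where
        i²·i⁴ʰ≡i²ⁿ : single i 2 · single i (2 * h + 2 * h) ≡ i²ⁿ
        i²·i⁴ʰ≡i²ⁿ = trans (single-+ i 2 (2 * h + 2 * h))
                           (cong (single i ∘ suc) (sym (ℕ.+-suc (2 * h) (2 * h))))

      atom-iⁿ : IsAtom M (single i n)
      atom-iⁿ = single-atom M⊆Bpm i≢0 (inj₂ refl)
        (M-divisor M-i²ⁿ (Bpm-single-n i) (Bpm-single-n i) (single-+ i n n))

      i²ⁿ-length-2 : HasLength M i²ⁿ 2
      i²ⁿ-length-2 =
        subst (λ v → HasLength M v 2) (trans (×ˢ-single i 2 n) (cong (single i ∘ _+_ n) (ℕ.+-identityʳ n)))
        (HasLength-×ˢ M (HasLength-atom M atom-iⁿ) 2)

      i²ⁿ-length-n : HasLength M i²ⁿ n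
      i²ⁿ-length-n =
        subst₂ (HasLength M) (trans (×ˢ-single i n 2) (cong (single i) n*2≡n+n)) (ℕ.*-identityʳ n)
        (HasLength-×ˢ M (HasLength-atom M atom-i²) n)
        where n*2≡n+n = trans (ℕ.*-comm n 2) (cong (_+_ n) (ℕ.+-identityʳ n))

    -- If d = l − k ∤ n − 2 with r = (n − 2) mod d > 0, then i²ⁿ · a^((n−2)/d) has two lengths r apart.
    ¬¬min-Δ∣n∸2 : ∀ {a k l} → M a → lookup a i ≢ 0 → HasLength M a k → HasLength M a l → k < l →
      (∀ e → InDelta M e → l ∸ k ≤ e) → ¬ ¬ (l ∸ k ∣ n ∸ 2)
    ¬¬min-Δ∣n∸2 {a} {k} {l} M-a aᵢ≢0 a-k a-l k<l d-min d∤n∸2 =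
      lengthGap⇒¬¬Δ≤ M M-y r 0<r y-short (subst (HasLength M y) long≡short+r y-long)
        λ (e , e≤r , Δe) → ℕ.<⇒≱ (m%n<n (n ∸ 2) d) (ℕ.≤-trans (d-min e Δe) e≤r)
      where
      d = l ∸ k
      instance
        d≢0 : NonZero d
        d≢0 = >-nonZero (ℕ.m<n⇒0<n∸m k<l)
      r = (n ∸ 2) % d
      q = (n ∸ 2) / d
      0<r : 0 < r
      0<r = ℕ.n≢0⇒n>0 λ r≡0 → d∤n∸2 (ℕ∣.m%n≡0⇒n∣m (n ∸ 2) d r≡0)
      M-i²ⁿ = i²ⁿ∈M M-a aᵢ≢0
      y = i²ⁿ · (q ×ˢ a)
      M-y : M y
      M-y = M-· M-i²ⁿ (M-×ˢ M-a q)
      y-short : HasLength M y (2 + q * l)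
      y-short = HasLength-· M (i²ⁿ-length-2 M-i²ⁿ) (HasLength-×ˢ M a-l q)
      y-long : HasLength M y (n + q * k)
      y-long = HasLength-· M (i²ⁿ-length-n M-i²ⁿ) (HasLength-×ˢ M a-k q)
      long≡short+r : n + q * k ≡ 2 + q * l + r
      long≡short+r = begin
        n + q * k                ≡⟨ cong (_+ q * k) n≡2+r+qd ⟩
        2 + (r + q * d) + q * k  ≡⟨ rearrange r q d k ⟩
        2 + q * (k + d) + r      ≡⟨ cong (λ m → 2 + q * m + r) (ℕ.m+[n∸m]≡n (ℕ.<⇒≤ k<l)) ⟩
        2 + q * l + r            ∎
        where
        open ≡-Reasoning
        n≡2+r+qd : n ≡ 2 + (r + q * d)
        n≡2+r+qd = trans (sym (ℕ.m+[n∸m]≡n 1<n)) (cong (_+_ 2) (m≡m%n+[m/n]*n (n ∸ 2) d))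
        rearrange : ∀ r q d k → 2 + (r + q * d) + q * k ≡ 2 + q * (k + d) + r
        rearrange = ℕ-Solver.solve-∀

  min-Δ∣n∸2 : ∀ {M d} → IsDivClosedSubmonoid n M → IsMinDelta M d → d ∣ n ∸ 2
  min-Δ∣n∸2 {M} M-dc ((a , M-a , k , l , a-k , a-l , k<l , refl , _) , d-min) =
    decidable-stable (l ∸ k ∣? n ∸ 2) ¬¬d∣n∸2
    where
    ¬¬d∣n∸2 : ¬ ¬ (l ∸ k ∣ n ∸ 2)
    ¬¬d∣n∸2 with Finₚ.any? (λ i → ¬? (toℕ i ℕ.≟ 0) ×-dec ¬? (lookup a i ℕ.≟ 0))
    ... | yes (i , i≢0 , aᵢ≢0) = Power2n.¬¬min-Δ∣n∸2 M-dc i≢0 M-a aᵢ≢0 a-k a-l k<l d-min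
    ... | no no-nonzero-entry = ⊥-elim (ℕ.<-irrefl k≡l k<l)
      where
      a-supp : ZeroSupported a
      a-supp j j≢0 = decidable-stable (lookup a j ℕ.≟ 0)
        λ aⱼ≢0 → no-nonzero-entry (j , (λ j≡0 → j≢0 (Finₚ.toℕ-injective j≡0)) , aⱼ≢0)
      k≡l : k ≡ l
      k≡l = trans (length-zero-supported M-dc a-supp a-k) (sym (length-zero-supported M-dc a-supp a-l))

  module Singleton (n∸2-prime : Prime (n ∸ 2)) {i : Fin n} (i≢0 : toℕ i ≢ 0) where

    Bpmᵢ : Seq n → Set
    Bpmᵢ v = Bpm n v × v ≡ single i (lookup v i)

    Bpmᵢ-single : ∀ {j} → Bpm n (single i j) → Bpmᵢ (single i j)
    Bpmᵢ-single Bpm-ij = Bpm-ij , cong (single i) (sym (lookup-single i _))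

    Bpmᵢ-divisorClosed : IsDivClosedSubmonoid n Bpmᵢ
    Bpmᵢ-divisorClosed =
      (λ _ → proj₁) , subst Bpmᵢ (single-0 i) (Bpmᵢ-single Bpm-𝟙′) , Bpmᵢ-· , Bpmᵢ-divisor
      where
      Bpm-𝟙′ : Bpm n (single i 0)
      Bpm-𝟙′ = subst (Bpm n) (sym (single-0 i)) Bpm-𝟙
      Bpmᵢ-· : ∀ u v → Bpmᵢ u → Bpmᵢ v → Bpmᵢ (u · v)
      Bpmᵢ-· u v (Bpm-u , u≡) (Bpm-v , v≡) = Bpm-· {n} {u} {v} Bpm-u Bpm-v ,
        trans (cong₂ _·_ u≡ v≡) (trans (single-+ i _ _) (cong (single i) (sym (lookup-· u v i))))
      Bpmᵢ-divisor : ∀ a b → Bpmᵢ a → Bpm n b → (∃ λ c → Bpm n c × b · c ≡ a) → Bpmᵢ b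
      Bpmᵢ-divisor a b (_ , a≡) Bpm-b (_ , _ , bc≡a) = Bpm-b , divisor-single i (trans bc≡a a≡)

    Bpm-single-2u+vn : ∀ u v → Bpm n (single i (2 * u + v * n))
    Bpm-single-2u+vn u v =
      subst (Bpm n) (single-+ i (2 * u) (v * n)) (Bpm-· {n} {single i (2 * u)} {single i (v * n)} Bpm-2u Bpm-vn)
      where
      Bpm-2u : Bpm n (single i (2 * u))
      Bpm-2u = subst (λ m → Bpm n (single i (u + m))) (sym (ℕ.+-identityʳ u)) (Bpm-single-double i u)
      Bpm-vn : Bpm n (single i (v * n))
      Bpm-vn = Bpm-single i (v * n) (ℕ∣.∣m⇒∣m*n (toℕ i) (ℕ∣.n∣m*n v))

    Bpm-single⇒2u+vn : ∀ {j} → Bpm n (single i j) → ∃ λ u → ∃ λ v → j ≡ 2 * u + v * n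
    Bpm-single⇒2u+vn {j} Bpm-ij with even⊎odd j
    ... | inj₁ (u , j≡2u) = u , 0 , trans j≡2u (sym (ℕ.+-identityʳ (2 * u)))
    ... | inj₂ (u , j≡1+2u) with j ℕ.<? n
    ...   | yes j<n = ⊥-elim (¬Bpm-single-odd i≢0 j<n u j≡1+2u Bpm-ij)
    ...   | no j≮n = map₂ (1 ,_) (odd≥n⇒2w+n {u = u} j≡1+2u (ℕ.≮⇒≥ j≮n))

    single-+-¬atom : ∀ {p q} → p ≢ 0 → q ≢ 0 → Bpm n (single i p) → Bpm n (single i q) →
      ¬ IsAtom Bpmᵢ (single i (p + q))
    single-+-¬atom p≢0 q≢0 Bpm-p Bpm-q (_ , _ , indecomposable) =
      [ single≢𝟙 i p≢0 , single≢𝟙 i q≢0 ]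
        (indecomposable _ _ (Bpmᵢ-single Bpm-p) (Bpmᵢ-single Bpm-q) (sym (single-+ i _ _)))

    atom-exponent : ∀ {j} → IsAtom Bpmᵢ (single i j) → j ≡ 2 ⊎ j ≡ n
    atom-exponent {j} atom with Bpm-single⇒2u+vn (proj₁ (proj₁ atom))
    ... | 0 , 0 , refl = ⊥-elim (proj₁ (proj₂ atom) (single-0 i))
    ... | 1 , 0 , refl = inj₁ refl
    ... | 0 , 1 , refl = inj₂ (ℕ.+-identityʳ n)
    ... | 0 , suc (suc v) , refl =
      ⊥-elim (single-+-¬atom (λ ()) (λ ()) (Bpm-single-n i) (Bpm-single-2u+vn 0 (suc v)) atom)
    ... | suc (suc u) , v , refl =
      ⊥-elim (single-+-¬atom (λ ()) (λ ()) (Bpm-single-2u+vn 1 0) (Bpm-single-2u+vn (suc u) v)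
        (subst (IsAtom Bpmᵢ ∘ single i) (cong (_+ v * n) (ℕ.*-suc 2 (suc u))) atom))
    ... | suc u , suc v , refl =
      ⊥-elim (single-+-¬atom (λ ()) (ℕ.m+1+n≢0 (2 * u)) (Bpm-single-2u+vn 1 0) (Bpm-single-2u+vn u (suc v))
        (subst (IsAtom Bpmᵢ ∘ single i) (cong (_+ suc v * n) (ℕ.*-suc 2 u)) atom))

    length-exponent : ∀ {y m} → HasLength Bpmᵢ y m →
      ∃ λ u → ∃ λ v → m ≡ u + v × lookup y i ≡ 2 * u + v * n
    length-exponent (bs , refl , bs-atoms , refl) = count bs bs-atoms
      where
      count : ∀ bs → All (IsAtom Bpmᵢ) bs →
        ∃ λ u → ∃ λ v → length bs ≡ u + v × lookup (prod bs) i ≡ 2 * u + v * n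
      count [] [] = 0 , 0 , refl , lookup-𝟙 i
      count (b ∷ bs) (b-atom ∷ bs-atoms)
        with count bs bs-atoms | atom-exponent (subst (IsAtom Bpmᵢ) (proj₂ (proj₁ b-atom)) b-atom)
      ... | u , v , len≡ , exp≡ | inj₁ bᵢ≡2 = suc u , v , cong suc len≡ ,
        trans (lookup-· b (prod bs) i) (trans (cong₂ _+_ bᵢ≡2 exp≡) (cong (_+ v * n) (sym (ℕ.*-suc 2 u))))
      ... | u , v , len≡ , exp≡ | inj₂ bᵢ≡n = u , suc v , trans (cong suc len≡) (sym (ℕ.+-suc u v)) ,
        trans (lookup-· b (prod bs) i) (trans (cong₂ _+_ bᵢ≡n exp≡) (left-comm n (2 * u) (v * n)))
        where left-comm : ∀ a b c → a + (b + c) ≡ b + (a + c)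
              left-comm = ℕ-Solver.solve-∀

    n∸2∣length-difference : ∀ {y k l} → HasLength Bpmᵢ y k → HasLength Bpmᵢ y l → n ∸ 2 ∣ l ∸ k
    n∸2∣length-difference y-k y-l with length-exponent y-k | length-exponent y-l
    ... | u , v , refl , yᵢ≡ | u′ , v′ , refl , yᵢ≡′ =
      2k+cv≡2l+cv′⇒c∣l∸k {k = u + v} {l = u′ + v′} n∸2-prime n∸2≢2
        (trans (regroup u v) (trans (sym yᵢ≡) (trans yᵢ≡′ (sym (regroup u′ v′)))))
      where
      regroup : ∀ u v → 2 * (u + v) + (n ∸ 2) * v ≡ 2 * u + v * n
      regroup u v = trans (ring u v (n ∸ 2)) (cong (λ m → 2 * u + v * m) (ℕ.m+[n∸m]≡n 1<n))
        where ring : ∀ u v c → 2 * (u + v) + c * v ≡ 2 * u + v * (2 + c)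
              ring = ℕ-Solver.solve-∀

    n∸2∈Δ* : InDeltaStar n (n ∸ 2)
    n∸2∈Δ* = Bpmᵢ , Bpmᵢ-divisorClosed ,
      (i²ⁿ , Bpmᵢ-i²ⁿ , 2 , n , i²ⁿ-length-2 Bpmᵢ-i²ⁿ , i²ⁿ-length-n Bpmᵢ-i²ⁿ ,
        2<n , refl , no-length-between) ,
      n∸2≤Δ
      where
      open Power2n Bpmᵢ-divisorClosed i≢0
      Bpmᵢ-i²ⁿ : Bpmᵢ i²ⁿ
      Bpmᵢ-i²ⁿ = Bpmᵢ-single (Bpm-single-double i n)
      no-length-between : ∀ m → HasLength Bpmᵢ i²ⁿ m → ¬ (2 < m × m < n)
      no-length-between m i²ⁿ-length-m (2<m , m<n) =
        ℕ.<⇒≱ (ℕ.∸-monoˡ-< m<n (ℕ.<⇒≤ 2<m))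
          (ℕ∣.∣⇒≤ {{>-nonZero (ℕ.m<n⇒0<n∸m 2<m)}}
            (n∸2∣length-difference (i²ⁿ-length-2 Bpmᵢ-i²ⁿ) i²ⁿ-length-m))
      n∸2≤Δ : ∀ e → InDelta Bpmᵢ e → n ∸ 2 ≤ e
      n∸2≤Δ e (_ , _ , k , l , y-k , y-l , k<l , refl , _) =
        ℕ∣.∣⇒≤ {{>-nonZero (ℕ.m<n⇒0<n∸m k<l)}} (n∸2∣length-difference y-k y-l)

  g g′ : Fin n
  g = Fin.fromℕ< 1<n
  g′ = Fin.fromℕ< 2<n

  toℕ-g : toℕ g ≡ 1
  toℕ-g = Finₚ.toℕ-fromℕ< 1<n

  toℕ-g′ : toℕ g′ ≡ 2
  toℕ-g′ = Finₚ.toℕ-fromℕ< 2<n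

  g≢0 : toℕ g ≢ 0
  g≢0 g≡0 with () ← trans (sym toℕ-g) g≡0

  g′≢0 : toℕ g′ ≢ 0
  g′≢0 g′≡0 with () ← trans (sym toℕ-g′) g′≡0

  g≢g′ : g ≢ g′
  g≢g′ g≡g′ with () ← trans (sym toℕ-g) (trans (cong toℕ g≡g′) toℕ-g′)

  pair : ℕ → ℕ → Seq n
  pair p q = single g p · single g′ q

  lookup-pair-g : ∀ p q → lookup (pair p q) g ≡ p
  lookup-pair-g p q = trans (lookup-· (single g p) (single g′ q) g)
    (trans (cong₂ _+_ (lookup-single g p) (lookup-single-≢ q g≢g′)) (ℕ.+-identityʳ p))

  lookup-pair-g′ : ∀ p q → lookup (pair p q) g′ ≡ q
  lookup-pair-g′ p q = trans (lookup-· (single g p) (single g′ q) g′)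
    (cong₂ _+_ (lookup-single-≢ p (g≢g′ ∘ sym)) (lookup-single g′ q))

  lookup-pair-≢ : ∀ {p q k} → k ≢ g → k ≢ g′ → lookup (pair p q) k ≡ 0
  lookup-pair-≢ {p} {q} {k} k≢g k≢g′ =
    trans (lookup-· (single g p) (single g′ q) k)
      (cong₂ _+_ (lookup-single-≢ p k≢g) (lookup-single-≢ q k≢g′))

  ≡pair : ∀ {v} → (∀ k → k ≢ g → k ≢ g′ → lookup v k ≡ 0) → v ≡ pair (lookup v g) (lookup v g′)
  ≡pair {v} v≡0 = Seq-ext at
    where
    at : ∀ k → lookup v k ≡ lookup (pair (lookup v g) (lookup v g′)) k
    at k with k ≟ g | k ≟ g′
    ... | yes refl | _ = sym (lookup-pair-g _ _)
    ... | no _ | yes refl = sym (lookup-pair-g′ _ _)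
    ... | no k≢g | no k≢g′ = trans (v≡0 k k≢g k≢g′) (sym (lookup-pair-≢ k≢g k≢g′))

  divisor-pair : ∀ {b c p q} → b · c ≡ pair p q → b ≡ pair (lookup b g) (lookup b g′)
  divisor-pair bc≡pq = ≡pair λ k k≢g k≢g′ → divisor-lookup-0 k bc≡pq (lookup-pair-≢ k≢g k≢g′)

  pair-0ʳ : ∀ p → pair p 0 ≡ single g p
  pair-0ʳ p = trans (cong (single g p ·_) (single-0 g′)) (·-identityʳ (single g p))

  pair-0ˡ : ∀ q → pair 0 q ≡ single g′ q
  pair-0ˡ q = trans (cong (_· single g′ q) (single-0 g)) (·-identityˡ (single g′ q))

  ¬Bpm-pair-1-0 : ¬ Bpm n (pair 1 0)
  ¬Bpm-pair-1-0 Bpm-g = ¬Bpm-single-odd g≢0 1<n 0 refl (subst (Bpm n) (pair-0ʳ 1) Bpm-g)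

  ¬Bpm-pair-0-1 : ¬ Bpm n (pair 0 1)
  ¬Bpm-pair-0-1 Bpm-g′ = ¬Bpm-single-odd g′≢0 1<n 0 refl (subst (Bpm n) (pair-0ˡ 1) Bpm-g′)

  -- Every nontrivial splitting of g²·g′ has a part equal to g or to g′.
  pair-2-1-factors : ∀ {p q p′ q′} → p + p′ ≡ 2 → q + q′ ≡ 1 →
    Bpm n (pair p q) → Bpm n (pair p′ q′) →
    (p ≡ 0 × q ≡ 0) ⊎ (p′ ≡ 0 × q′ ≡ 0)
  pair-2-1-factors {0} {0} refl refl _ _ = inj₁ (refl , refl)
  pair-2-1-factors {0} {1} refl refl Bpm-pq _ = ⊥-elim (¬Bpm-pair-0-1 Bpm-pq)
  pair-2-1-factors {1} {0} refl refl Bpm-pq _ = ⊥-elim (¬Bpm-pair-1-0 Bpm-pq)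
  pair-2-1-factors {1} {1} refl refl _ Bpm-p′q′ = ⊥-elim (¬Bpm-pair-1-0 Bpm-p′q′)
  pair-2-1-factors {2} {0} refl refl _ Bpm-p′q′ = ⊥-elim (¬Bpm-pair-0-1 Bpm-p′q′)
  pair-2-1-factors {2} {1} refl refl _ _ = inj₂ (refl , refl)
  pair-2-1-factors {suc (suc (suc _))} () _ _ _
  pair-2-1-factors {_} {suc (suc _)} _ () _ _

  g²g′ : Seq n
  g²g′ = pair 2 1

  Bpm-g²g′ : Bpm n g²g′
  Bpm-g²g′ = Bpm-signedSum≡0 {v = g²g′} (pair 2 0)
    (·-mono-≤ˢ {a = single g 2} {single g′ 0} {single g 2} {single g′ 1} 2≤2 0≤1) (begin
      ΣFin (signedTerm g²g′ (pair 2 0))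
        ≡⟨ signedSum-· {u = single g 2} {single g′ 1} {single g 2} {single g′ 0} 2≤2 0≤1 ⟩
      ΣFin (signedTerm (single g 2) (single g 2)) ℤ.+ ΣFin (signedTerm (single g′ 1) (single g′ 0))
        ≡⟨ cong₂ ℤ._+_ (signedSum-single g 2 2) (signedSum-single g′ 1 0) ⟩
      (+ 2 ℤ.- + 0) ℤ.* + toℕ g ℤ.+ (+ 0 ℤ.- + 1) ℤ.* + toℕ g′
        ≡⟨ cong₂ (λ s t → (+ 2 ℤ.- + 0) ℤ.* + s ℤ.+ (+ 0 ℤ.- + 1) ℤ.* + t) toℕ-g toℕ-g′ ⟩
      + 0
        ∎)
    where
    open ≡-Reasoning
    2≤2 : single g 2 ≤ˢ single g 2
    2≤2 = single-mono-≤ˢ g ℕ.≤-refl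
    0≤1 : single g′ 0 ≤ˢ single g′ 1
    0≤1 = single-mono-≤ˢ g′ z≤n

  atom-g²g′ : IsAtom (Bpm n) g²g′
  atom-g²g′ = Bpm-g²g′ , g²g′≢𝟙 , indecomposable
    where
    g²g′≢𝟙 : g²g′ ≢ 𝟙
    g²g′≢𝟙 g²g′≡𝟙 with () ←
      trans (sym (lookup-pair-g 2 1)) (trans (cong (λ v → lookup v g) g²g′≡𝟙) (lookup-𝟙 g))
    pair-0-0 : pair 0 0 ≡ 𝟙
    pair-0-0 = trans (pair-0ʳ 0) (single-0 g)
    indecomposable : ∀ b c → Bpm n b → Bpm n c → g²g′ ≡ b · c → b ≡ 𝟙 ⊎ c ≡ 𝟙
    indecomposable b c Bpm-b Bpm-c g²g′≡bc =
      Sum.map (λ (b-g≡0 , b-g′≡0) → trans b≡ (trans (cong₂ pair b-g≡0 b-g′≡0) pair-0-0))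
              (λ (c-g≡0 , c-g′≡0) → trans c≡ (trans (cong₂ pair c-g≡0 c-g′≡0) pair-0-0))
              (pair-2-1-factors (trans (lookup-factors (sym g²g′≡bc) g) (lookup-pair-g 2 1))
                                (trans (lookup-factors (sym g²g′≡bc) g′) (lookup-pair-g′ 2 1))
                                (subst (Bpm n) b≡ Bpm-b) (subst (Bpm n) c≡ Bpm-c))
      where
      b≡ : b ≡ pair (lookup b g) (lookup b g′)
      b≡ = divisor-pair (sym g²g′≡bc)
      c≡ : c ≡ pair (lookup c g) (lookup c g′)
      c≡ = divisor-pair (trans (·-comm c b) (sym g²g′≡bc))

  atom-g² : IsAtom (Bpm n) (single g 2)
  atom-g² = single-atom (λ Bpm-a → Bpm-a) g≢0 (inj₁ refl) (Bpm-single-double g 1)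

  atom-g′² : IsAtom (Bpm n) (single g′ 2)
  atom-g′² = single-atom (λ Bpm-a → Bpm-a) g′≢0 (inj₁ refl) (Bpm-single-double g′ 1)

  [g²g′]²≡g²g²g′² : g²g′ · g²g′ ≡ (single g 2 · single g 2) · single g′ 2
  [g²g′]²≡g²g²g′² = trans (·-interchange (single g 2) (single g′ 1) (single g 2) (single g′ 1))
                     (cong ((single g 2 · single g 2) ·_) (single-+ g′ 1 1))

  1∈Δ* : InDeltaStar n 1
  1∈Δ* = Bpm n , Bpm-divisorClosed ,
    (g²g′ · g²g′ , Bpm-· {u = g²g′} {g²g′} Bpm-g²g′ Bpm-g²g′ ,
      2 , 3 , length-2 , length-3 , ℕ.≤-refl , refl , nothing-between) ,
    λ e (_ , _ , k , l , _ , _ , k<l , e≡l∸k , _) → subst (1 ≤_) (sym e≡l∸k) (ℕ.m<n⇒0<n∸m k<l)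
    where
    length-2 : HasLength (Bpm n) (g²g′ · g²g′) 2
    length-2 = HasLength-· (Bpm n) (HasLength-atom (Bpm n) atom-g²g′) (HasLength-atom (Bpm n) atom-g²g′)
    length-3 : HasLength (Bpm n) (g²g′ · g²g′) 3
    length-3 = subst (λ v → HasLength (Bpm n) v 3) (sym [g²g′]²≡g²g²g′²)
      (HasLength-· (Bpm n) (HasLength-· (Bpm n) (HasLength-atom (Bpm n) atom-g²) (HasLength-atom (Bpm n) atom-g²))
                           (HasLength-atom (Bpm n) atom-g′²))
    nothing-between : ∀ m → HasLength (Bpm n) (g²g′ · g²g′) m → ¬ (2 < m × m < 3)
    nothing-between m _ (2<m , m<3) = ℕ.<⇒≱ 2<m (ℕ.≤-pred m<3)

twin-prime⇒odd : ∀ {n} → Prime n → Prime (n ∸ 2) → ∃ λ h → n ≡ suc (2 * h)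
twin-prime⇒odd {n} n-prime n∸2-prime with even⊎odd n
... | inj₂ n-odd = n-odd
... | inj₁ (u , n≡2u) with prime⇒irreducible n-prime (ℕ∣.divides u (trans n≡2u (ℕ.*-comm 2 u)))
...   | inj₁ ()
...   | inj₂ refl = ⊥-elim (¬prime[0] n∸2-prime)

corollary4p10 : (n : ℕ) → Prime n → Prime (n ∸ 2) →
    (d : ℕ) → (InDeltaStar n d → d ≡ 1 ⊎ d ≡ n ∸ 2) × (d ≡ 1 ⊎ d ≡ n ∸ 2 → InDeltaStar n d)
corollary4p10 n n-prime n∸2-prime d with twin-prime⇒odd n-prime n∸2-prime
... | h , refl = (λ (M , M-dc , d-min) → prime⇒irreducible n∸2-prime (min-Δ∣n∸2 M-dc d-min))
               , λ { (inj₁ refl) → 1∈Δ* ; (inj₂ refl) → Singleton.n∸2∈Δ* n∸2-prime g≢0 }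
  where open OddPrime {h} n-prime
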